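{- Let $\mathcal H$ be the infinite weighted directed graph with vertex set $\{A_i,B_i,C_i,D_i : i\ge0\}$ and edges: $A_i\to B_i$ of weight $1$ and $A_j\to B_i$ of weight $z$ for all $j>i\ge0$; $B_i\to C_i$ of weight $z$ for $i\ge0$; $C_i\to D_i$ of weight $1$ and $C_j\to D_i$ of weight $z$ for all $j>i\ge0$; $D_i\to A_{i+1}$ of weight $z$ for $i\ge0$. The weight of a walk is the product of the weights of its edges. For $k\ge0$ let $a_k,b_k,c_k,d_k$ be the sums of the weights of all walks in $\mathcal H$ starting at $A_0$ and ending at $A_k,B_k,C_k,D_k$ respectively (the empty walk contributes $1$ to $a_0$); equivalently they are the unique formal power series with $a_0=1$, $a_i=zd_{i-1}$ $(i\ge1)$, $b_i=a_i+z\sum_{j>i}a_j$, $c_i=zb_i$, $d_i=c_i+z\sum_{j>i}c_j$. Let $r=r(z)$ be the unique formal power series with $r(0)=0$ satisfying $$z^2+(2z^3-2z^2-1)r+(2+z^2-2z^3+z^4)r^2-r^3=0,$$ and let $\rho=1/r$ (a Laurent series $\rho=z^{ -2}-2z-2z^3-\cdots$), which is a root of $z^2\rho^3+(2z^3-2z^2-1)\rho^2+(2+z^2-2z^3+z^4)\rho-1=0$. Then $\sum_{k\ge0}a_ku^k=\frac{\rho}{\rho-u}$, $\sum_{k\ge0}c_ku^k=\frac{1-\rho}{z(1-\rho-z)(\rho-u)}$, and for every $k\ge0$ $$a_k=\rho^{ -k},\qquad c_k=\frac{1-\rho}{z(1-\rho-z)}\rho^{ -k-1},\qquad b_k=\frac1z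 c_k,\qquad d_k=\frac1z a_{k+1}.$$
   Context: The graph $\mathcal H$ encodes $S$-Motzkin paths with air pockets: flat steps (edges $B_i\to C_i$) and up steps (edges $D_i\to A_{i+1}$) alternate, starting with a flat step; between them a single "air pocket" may occur, namely a maximal run of down steps dropping from level $j$ to any level $i<j$, counted as one step (weight $z$); two down steps never follow each other as separate steps. Edges of weight $1$ mean no step is taken. -}

module Defs where

open import Data.Nat using (ℕ; zero; suc; _∸_; _≤_)
open import Data.Integer using (ℤ; 0ℤ; 1ℤ; _+_; _*_; -_)
open import Data.List using (List; []; _∷_)
open import Data.Product using (Σ; _×_; ∃)
open import Relation.Binary.PropositionalEquality using (_≡_)

-- Formal power series in z with integer coefficients: n ↦ [z^n].
FPS : Set
FPS = ℕ → ℤ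

sumLt : ℕ → (ℕ → ℤ) → ℤ
sumLt zero    h = 0ℤ
sumLt (suc n) h = sumLt n h + h n

_≈_ : FPS → FPS → Set
f ≈ g = ∀ n → f n ≡ g n
infix 4 _≈_

zeroS : FPS
zeroS _ = 0ℤ

oneS : FPS
oneS zero    = 1ℤ
oneS (suc _) = 0ℤ

Z : FPS
Z (suc zero) = 1ℤ
Z _          = 0ℤ

poly : List ℤ → FPS
poly []       _       = 0ℤ
poly (c ∷ cs) zero    = c
poly (c ∷ cs) (suc n) = poly cs n

_⊕_ : FPS → FPS → FPS
(f ⊕ g) n = f n + g n

⊖_ : FPS → FPS
(⊖ f) n = - f n

_⊝_ : FPS → FPS → FPS
f ⊝ g = f ⊕ (⊖ g)

_⊛_ : FPS → FPS → FPS
(f ⊛ g) n = sumLt (suc n) (λ i → f i * g (n ∸ i))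

infixl 6 _⊕_ _⊝_
infixl 7 _⊛_
infix 8 ⊖_

_^ˢ_ : FPS → ℕ → FPS
f ^ˢ zero  = oneS
f ^ˢ suc k = f ⊛ (f ^ˢ k)
infixr 9 _^ˢ_

-- Formal infinite sum Σ_{j > i} f j of a family of power series
-- (coefficientwise finite): for every degree n there is N such that
-- [z^n] f (i+1+t) = 0 for all t ≥ N, and [z^n] s = Σ_{t<N} [z^n] f (i+1+t).
TailSum : (ℕ → FPS) → ℕ → FPS → Set
TailSum f i s = ∀ n → ∃ λ N →
  (∀ t → N ≤ t → f (suc i Data.Nat.+ t) n ≡ 0ℤ) ×
  (s n ≡ sumLt N (λ t → f (suc i Data.Nat.+ t) n))

-- Bivariate series Σ_k F_k(z) u^k, represented by k ↦ F_k.
BPS : Set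
BPS = ℕ → FPS

_≈ᵇ_ : BPS → BPS → Set
F ≈ᵇ G = ∀ k → F k ≈ G k
infix 4 _≈ᵇ_

sumLtS : ℕ → (ℕ → FPS) → FPS
sumLtS zero    h = zeroS
sumLtS (suc n) h = sumLtS n h ⊕ h n

_⊛ᵇ_ : BPS → BPS → BPS
(F ⊛ᵇ G) k = sumLtS (suc k) (λ i → F i ⊛ G (k ∸ i))
infixl 7 _⊛ᵇ_

constB : FPS → BPS
constB f zero    = f
constB f (suc _) = zeroS

oneMinusU : FPS → BPS
oneMinusU f zero          = oneS
oneMinusU f (suc zero)    = ⊖ f
oneMinusU f (suc (suc _)) = zeroS

IsWalkSystem : (a b c d : ℕ → FPS) → Set
IsWalkSystem a b c d =
  (a 0 ≈ oneS) ×
  (∀ i → a (suc i) ≈ Z ⊛ d i) ×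
  (∀ i → Σ FPS λ s → TailSum a i s × (b i ≈ a i ⊕ Z ⊛ s)) ×
  (∀ i → c i ≈ Z ⊛ b i) ×
  (∀ i → Σ FPS λ s → TailSum c i s × (d i ≈ c i ⊕ Z ⊛ s))

IsR : FPS → Set
IsR r =
  (r 0 ≡ 0ℤ) ×
  (poly (0ℤ ∷ 0ℤ ∷ 1ℤ ∷ [])
     ⊕ poly (- 1ℤ ∷ 0ℤ ∷ - (1ℤ + 1ℤ) ∷ (1ℤ + 1ℤ) ∷ []) ⊛ r
     ⊕ poly ((1ℤ + 1ℤ) ∷ 0ℤ ∷ 1ℤ ∷ - (1ℤ + 1ℤ) ∷ 1ℤ ∷ []) ⊛ r ^ˢ 2
     ⊝ r ^ˢ 3
   ≈ zeroS)

-- The system determines its solution degree by degree, so it suffices to exhibit one. With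
-- g = 1/(1-r) = Σ r^t and Q = 1 - r + z r, take a_k = r^k, b_k = r^k Q g, c_k = z b_k and
-- d_k = c_k Q g. Tail sums of such geometric families are geometric, Σ_{j>i} r^j W = r^(i+1) W g,
-- and Q g = 1 + z r g, which gives the equations for b and d. The equation a_(k+1) = z d_k
-- reduces to (z Q g)^2 = r, i.e. to the cubic for r in the form r (1-r)^2 = z^2 Q^2. The
-- generating functions follow because 1 - u r annihilates Σ_k r^k W u^k.

module Submission where

open import Defs
open import Data.Nat using (ℕ; zero; suc; _∸_; _≤_; _<_; z≤n; s≤s)
import Data.Nat as ℕ
import Data.Nat.Properties as ℕ
open import Data.Integer using (ℤ; 0ℤ; 1ℤ; _+_; _*_; -_)
import Data.Integer.Properties as ℤ
open import Data.Integer.Solver using (module +-*-Solver)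
open import Data.Product using (_×_; _,_; Σ; proj₁; proj₂)
open import Data.Sum using (inj₁; inj₂)
open import Data.Maybe using (Maybe; just; nothing)
open import Data.List using (List; []; _∷_)
open import Data.Vec using (Vec; []; _∷_)
open import Data.Fin using (Fin)
open import Relation.Nullary using (yes; no)
open import Relation.Binary.PropositionalEquality
  using (_≡_; refl; sym; trans; cong; cong₂; subst; module ≡-Reasoning)
open import Level using (0ℓ)
open import Algebra.Bundles using (CommutativeRing)
open import Algebra.Solver.Ring.AlmostCommutativeRing
  using (fromCommutativeRing; _-Raw-AlmostCommutative⟶_)
import Algebra.Solver.Ring as RingSolver

sumLt-cong : ∀ n {h h′ : ℕ → ℤ} → (∀ i → i < n → h i ≡ h′ i) → sumLt n h ≡ sumLt n h′
sumLt-cong zero    eq = refl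
sumLt-cong (suc n) eq =
  cong₂ _+_ (sumLt-cong n (λ i i<n → eq i (ℕ.m<n⇒m<1+n i<n))) (eq n ℕ.≤-refl)

sumLt-zero : ∀ n {h : ℕ → ℤ} → (∀ i → i < n → h i ≡ 0ℤ) → sumLt n h ≡ 0ℤ
sumLt-zero zero    eq = refl
sumLt-zero (suc n) eq =
  cong₂ _+_ (sumLt-zero n (λ i i<n → eq i (ℕ.m<n⇒m<1+n i<n))) (eq n ℕ.≤-refl)

sumLt-+ : ∀ n (h g : ℕ → ℤ) → sumLt n (λ i → h i + g i) ≡ sumLt n h + sumLt n g
sumLt-+ zero    h g = refl
sumLt-+ (suc n) h g =
  trans (cong (_+ (h n + g n)) (sumLt-+ n h g)) (swap (sumLt n h) (sumLt n g) (h n) (g n))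
  where
  open +-*-Solver
  swap : ∀ a b c d → (a + b) + (c + d) ≡ (a + c) + (b + d)
  swap = solve 4 (λ a b c d → (a :+ b) :+ (c :+ d) := (a :+ c) :+ (b :+ d)) refl

sumLt-*ˡ : ∀ n c (h : ℕ → ℤ) → sumLt n (λ i → c * h i) ≡ c * sumLt n h
sumLt-*ˡ zero    c h = sym (ℤ.*-zeroʳ c)
sumLt-*ˡ (suc n) c h =
  trans (cong (_+ c * h n) (sumLt-*ˡ n c h)) (sym (ℤ.*-distribˡ-+ c (sumLt n h) (h n)))

sumLt-sucˡ : ∀ n (h : ℕ → ℤ) → sumLt (suc n) h ≡ h 0 + sumLt n (λ i → h (suc i))
sumLt-sucˡ zero    h = trans (ℤ.+-identityˡ (h 0)) (sym (ℤ.+-identityʳ (h 0)))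
sumLt-sucˡ (suc n) h =
  trans (cong (_+ h (suc n)) (sumLt-sucˡ n h)) (ℤ.+-assoc (h 0) _ (h (suc n)))

sumLt-reverse : ∀ n (h : ℕ → ℤ) → sumLt n h ≡ sumLt n (λ i → h (n ∸ suc i))
sumLt-reverse zero    h = refl
sumLt-reverse (suc n) h =
  trans (cong (_+ h n) (sumLt-reverse n h))
        (trans (ℤ.+-comm _ (h n)) (sym (sumLt-sucˡ n (λ i → h (n ∸ i)))))

sumLt-vanishingTail : ∀ {j n} (h : ℕ → ℤ) → j ≤ n → (∀ t → j ≤ t → h t ≡ 0ℤ) →
                      sumLt n h ≡ sumLt j h
sumLt-vanishingTail {n = zero}  h z≤n  vanish = refl
sumLt-vanishingTail {n = suc n} h j≤1+n vanish with ℕ.m≤n⇒m<n∨m≡n j≤1+n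
... | inj₂ refl = refl
... | inj₁ j<1+n =
  trans (cong₂ _+_ (sumLt-vanishingTail h (ℕ.≤-pred j<1+n) vanish) (vanish n (ℕ.≤-pred j<1+n)))
        (ℤ.+-identityʳ _)

sumLt-independent : ∀ {N N′} (h : ℕ → ℤ) → (∀ t → N ≤ t → h t ≡ 0ℤ) → (∀ t → N′ ≤ t → h t ≡ 0ℤ) →
                    sumLt N h ≡ sumLt N′ h
sumLt-independent {N} {N′} h vanish vanish′ with ℕ.≤-total N N′
... | inj₁ N≤N′ = sym (sumLt-vanishingTail h N≤N′ vanish)
... | inj₂ N′≤N = sumLt-vanishingTail h N′≤N vanish′

shift : FPS → FPS
shift f n = f (suc n)

_·_ : ℤ → FPS → FPS
(c · f) n = c * f n

≈-refl : ∀ {f} → f ≈ f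
≈-refl n = refl

≈-sym : ∀ {f g} → f ≈ g → g ≈ f
≈-sym eq n = sym (eq n)

≈-trans : ∀ {f g h} → f ≈ g → g ≈ h → f ≈ h
≈-trans eq eq′ n = trans (eq n) (eq′ n)

⊛-cong : ∀ {f f′ g g′} → f ≈ f′ → g ≈ g′ → f ⊛ g ≈ f′ ⊛ g′
⊛-cong eq eq′ n = sumLt-cong (suc n) (λ i _ → cong₂ _*_ (eq i) (eq′ (n ∸ i)))

⊛-local : ∀ f {g g′} n → (∀ j → j ≤ n → g j ≡ g′ j) → (f ⊛ g) n ≡ (f ⊛ g′) n
⊛-local f n eq = sumLt-cong (suc n) (λ i _ → cong (f i *_) (eq (n ∸ i) (ℕ.m∸n≤m n i)))

⊛-zero : ∀ f g → (f ⊛ g) 0 ≡ f 0 * g 0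
⊛-zero f g = ℤ.+-identityˡ _

⊛-suc : ∀ f g n → (f ⊛ g) (suc n) ≡ f 0 * g (suc n) + (shift f ⊛ g) n
⊛-suc f g n = sumLt-sucˡ (suc n) (λ i → f i * g (suc n ∸ i))

⊛-comm : ∀ f g → f ⊛ g ≈ g ⊛ f
⊛-comm f g n =
  trans (sumLt-reverse (suc n) (λ i → f i * g (n ∸ i)))
        (sumLt-cong (suc n) (λ i i<1+n →
          trans (cong (λ m → f (n ∸ i) * g m) (ℕ.m∸[m∸n]≡n (ℕ.≤-pred i<1+n)))
                (ℤ.*-comm (f (n ∸ i)) (g i))))

⊛-distribʳ : ∀ f g h → (f ⊕ g) ⊛ h ≈ f ⊛ h ⊕ g ⊛ h
⊛-distribʳ f g h n =
  trans (sumLt-cong (suc n) (λ i _ → ℤ.*-distribʳ-+ (h (n ∸ i)) (f i) (g i)))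
        (sumLt-+ (suc n) _ _)

⊛-scaleˡ : ∀ c f g → (c · f) ⊛ g ≈ c · (f ⊛ g)
⊛-scaleˡ c f g n =
  trans (sumLt-cong (suc n) (λ i _ → ℤ.*-assoc c (f i) (g (n ∸ i)))) (sumLt-*ˡ (suc n) c _)

-- Splitting off f 0 from the coefficient of z^(n+1) leaves a product with shift f of degree n.
⊛-assoc : ∀ f g h → (f ⊛ g) ⊛ h ≈ f ⊛ (g ⊛ h)
⊛-assoc f g h zero =
  begin
    ((f ⊛ g) ⊛ h) 0   ≡⟨ ⊛-zero (f ⊛ g) h ⟩
    (f ⊛ g) 0 * h 0   ≡⟨ cong (_* h 0) (⊛-zero f g) ⟩
    f 0 * g 0 * h 0   ≡⟨ ℤ.*-assoc (f 0) (g 0) (h 0) ⟩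
    f 0 * (g 0 * h 0) ≡⟨ cong (f 0 *_) (sym (⊛-zero g h)) ⟩
    f 0 * (g ⊛ h) 0   ≡⟨ sym (⊛-zero f (g ⊛ h)) ⟩
    (f ⊛ (g ⊛ h)) 0   ∎
  where open ≡-Reasoning
⊛-assoc f g h (suc n) =
  begin
    ((f ⊛ g) ⊛ h) (suc n)
      ≡⟨ ⊛-suc (f ⊛ g) h n ⟩
    (f ⊛ g) 0 * h (suc n) + (shift (f ⊛ g) ⊛ h) n
      ≡⟨ cong₂ _+_ (cong (_* h (suc n)) (⊛-zero f g)) (⊛-cong {g = h} (⊛-suc f g) ≈-refl n) ⟩
    f 0 * g 0 * h (suc n) + ((f 0 · shift g ⊕ shift f ⊛ g) ⊛ h) n
      ≡⟨ cong (f 0 * g 0 * h (suc n) +_) (trans (⊛-distribʳ (f 0 · shift g) (shift f ⊛ g) h n)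
           (cong₂ _+_ (⊛-scaleˡ (f 0) (shift g) h n) (⊛-assoc (shift f) g h n))) ⟩
    f 0 * g 0 * h (suc n) + (f 0 * (shift g ⊛ h) n + (shift f ⊛ (g ⊛ h)) n)
      ≡⟨ regroup (f 0) (g 0) (h (suc n)) ((shift g ⊛ h) n) ((shift f ⊛ (g ⊛ h)) n) ⟩
    f 0 * (g 0 * h (suc n) + (shift g ⊛ h) n) + (shift f ⊛ (g ⊛ h)) n
      ≡⟨ cong (λ x → f 0 * x + (shift f ⊛ (g ⊛ h)) n) (sym (⊛-suc g h n)) ⟩
    f 0 * (g ⊛ h) (suc n) + (shift f ⊛ (g ⊛ h)) n
      ≡⟨ sym (⊛-suc f (g ⊛ h) n) ⟩
    (f ⊛ (g ⊛ h)) (suc n) ∎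
  where
  open ≡-Reasoning
  open +-*-Solver
  regroup : ∀ a b c d e → a * b * c + (a * d + e) ≡ a * (b * c + d) + e
  regroup = solve 5 (λ a b c d e → a :* b :* c :+ (a :* d :+ e) := a :* (b :* c :+ d) :+ e) refl

⊛-identityˡ : ∀ f → oneS ⊛ f ≈ f
⊛-identityˡ f zero    = trans (⊛-zero oneS f) (ℤ.*-identityˡ (f 0))
⊛-identityˡ f (suc n) =
  trans (⊛-suc oneS f n)
        (trans (cong₂ _+_ (ℤ.*-identityˡ (f (suc n))) (sumLt-zero (suc n) (λ _ _ → refl)))
               (ℤ.+-identityʳ _))

FPS-commutativeRing : CommutativeRing 0ℓ 0ℓ
FPS-commutativeRing = record
  { Carrier = FPS ; _≈_ = _≈_ ; _+_ = _⊕_ ; _*_ = _⊛_ ; -_ = ⊖_ ; 0# = zeroS ; 1# = oneS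
  ; isCommutativeRing = record
    { isRing = record
      { +-isAbelianGroup = record
        { isGroup = record
          { isMonoid = record
            { isSemigroup = record
              { isMagma = record
                { isEquivalence = record { refl = ≈-refl ; sym = ≈-sym ; trans = ≈-trans }
                ; ∙-cong = λ eq eq′ n → cong₂ _+_ (eq n) (eq′ n) }
              ; assoc = λ f g h n → ℤ.+-assoc (f n) (g n) (h n) }
            ; identity = (λ f n → ℤ.+-identityˡ (f n)) , (λ f n → ℤ.+-identityʳ (f n)) }
          ; inverse = (λ f n → ℤ.+-inverseˡ (f n)) , (λ f n → ℤ.+-inverseʳ (f n))
          ; ⁻¹-cong = λ eq n → cong -_ (eq n) }
        ; comm = λ f g n → ℤ.+-comm (f n) (g n) }
      ; *-cong = ⊛-cong
      ; *-assoc = ⊛-assoc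
      ; *-identity = ⊛-identityˡ , (λ f → ≈-trans (⊛-comm f oneS) (⊛-identityˡ f))
      ; distrib = (λ f g h → ≈-trans (⊛-comm f (g ⊕ h))
                     (≈-trans (⊛-distribʳ g h f) (λ n → cong₂ _+_ (⊛-comm g f n) (⊛-comm h f n))))
                , (λ f g h → ⊛-distribʳ g h f) }
    ; *-comm = ⊛-comm } }

open CommutativeRing FPS-commutativeRing public
  using (setoid; +-cong; -‿cong; *-identityˡ; *-identityʳ; zeroˡ; zeroʳ; *-assoc; -‿inverseʳ)

constS : ℤ → FPS
constS c zero    = c
constS c (suc _) = 0ℤ

constS-homomorphism : Data.Integer.+-*-rawRing -Raw-AlmostCommutative⟶ fromCommutativeRing FPS-commutativeRing
constS-homomorphism = record
  { ⟦_⟧    = constS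
  ; +-homo = λ { a b zero → refl ; a b (suc n) → refl }
  ; *-homo = λ { a b zero → sym (⊛-zero (constS a) (constS b))
               ; a b (suc n) → sym (trans (⊛-suc (constS a) (constS b) n)
                   (cong₂ _+_ (ℤ.*-zeroʳ a) (sumLt-zero (suc n) (λ _ _ → refl)))) }
  ; -‿homo = λ { a zero → refl ; a (suc n) → refl }
  ; 0-homo = λ { zero → refl ; (suc n) → refl }
  ; 1-homo = λ { zero → refl ; (suc n) → refl } }

constS-≟ : ∀ a b → Maybe (constS a ≈ constS b)
constS-≟ a b with a ℤ.≟ b
... | yes refl = just ≈-refl
... | no _     = nothing

module FPS-Solver = RingSolver Data.Integer.+-*-rawRing (fromCommutativeRing FPS-commutativeRing)
                      constS-homomorphism constS-≟
open FPS-Solver using (solve; _:+_; _:*_; _:-_; :-_; _:^_; _:=_; con; var; Polynomial)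
open import Relation.Binary.Reasoning.Setoid setoid

Z-⊛-zero : ∀ f → (Z ⊛ f) 0 ≡ 0ℤ
Z-⊛-zero f = ⊛-zero Z f

Z-⊛-suc : ∀ f n → (Z ⊛ f) (suc n) ≡ f n
Z-⊛-suc f n =
  trans (⊛-suc Z f n)
        (trans (ℤ.+-identityˡ _) (trans (⊛-cong {g = f} shift-Z ≈-refl n) (⊛-identityˡ f n)))
  where
  shift-Z : shift Z ≈ oneS
  shift-Z zero    = refl
  shift-Z (suc n) = refl

Z-⊛-local : ∀ f g n → (∀ m → suc m ≡ n → f m ≡ g m) → (Z ⊛ f) n ≡ (Z ⊛ g) n
Z-⊛-local f g zero    eq = trans (Z-⊛-zero f) (sym (Z-⊛-zero g))
Z-⊛-local f g (suc m) eq = trans (Z-⊛-suc f m) (trans (eq m refl) (sym (Z-⊛-suc g m)))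

poly-∷ : ∀ c cs → poly (c ∷ cs) ≈ constS c ⊕ Z ⊛ poly cs
poly-∷ c cs zero    = sym (trans (cong (c +_) (Z-⊛-zero (poly cs))) (ℤ.+-identityʳ c))
poly-∷ c cs (suc n) = sym (trans (ℤ.+-identityˡ _) (Z-⊛-suc (poly cs) n))

horner : ∀ {k} → List ℤ → Polynomial k → Polynomial k
horner []       z = con 0ℤ
horner (c ∷ cs) z = con c :+ z :* horner cs z

poly-horner : ∀ {k} cs (ρ : Vec FPS k) (z : Polynomial k) →
              FPS-Solver.⟦ z ⟧ ρ ≈ Z → poly cs ≈ FPS-Solver.⟦ horner cs z ⟧ ρ
poly-horner []       ρ z z≈Z zero    = refl
poly-horner []       ρ z z≈Z (suc n) = refl
poly-horner (c ∷ cs) ρ z z≈Z =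
  ≈-trans (poly-∷ c cs) (+-cong (≈-refl {constS c}) (⊛-cong (≈-sym z≈Z) (poly-horner cs ρ z z≈Z)))

𝟙 : ∀ {k} → Polynomial (suc k)
𝟙 = var Fin.zero :^ 0

Q : FPS → FPS
Q r = oneS ⊝ r ⊕ Z ⊛ r

coeff₀ coeff₁ coeff₂ : List ℤ
coeff₀ = 0ℤ ∷ 0ℤ ∷ 1ℤ ∷ []
coeff₁ = - 1ℤ ∷ 0ℤ ∷ - (1ℤ + 1ℤ) ∷ (1ℤ + 1ℤ) ∷ []
coeff₂ = (1ℤ + 1ℤ) ∷ 0ℤ ∷ 1ℤ ∷ - (1ℤ + 1ℤ) ∷ 1ℤ ∷ []

-- r(1-r)^2 - z^2 Q^2 expands to minus the cubic of IsR.
IsR-factorised : ∀ {r} → IsR r → r ⊛ ((oneS ⊝ r) ⊛ (oneS ⊝ r)) ≈ (Z ⊛ Z) ⊛ (Q r ⊛ Q r)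
IsR-factorised {r} (_ , cubic≈0) = begin
  r ⊛ ((oneS ⊝ r) ⊛ (oneS ⊝ r))          ≈⟨ solve 2 (λ z r → r :* ((𝟙 :- r) :* (𝟙 :- r))
                                                 := (z :* z) :* ((𝟙 :- r :+ z :* r) :* (𝟙 :- r :+ z :* r)) :- cubic z r)
                                               ≈-refl Z r ⟩
  (Z ⊛ Z) ⊛ (Q r ⊛ Q r) ⊝ cubicHorner    ≈⟨ +-cong (≈-refl {(Z ⊛ Z) ⊛ (Q r ⊛ Q r)}) (-‿cong cubic≈0′) ⟩
  (Z ⊛ Z) ⊛ (Q r ⊛ Q r) ⊝ zeroS          ≈⟨ (λ n → ℤ.+-identityʳ _) ⟩
  (Z ⊛ Z) ⊛ (Q r ⊛ Q r)                  ∎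
  where
  ρ : Vec FPS 2
  ρ = Z ∷ r ∷ []
  z : Polynomial 2
  z = var Fin.zero
  cubic : Polynomial 2 → Polynomial 2 → Polynomial 2
  cubic z r = horner coeff₀ z :+ horner coeff₁ z :* r :+ horner coeff₂ z :* (r :^ 2)
           :- r :^ 3
  cubicHorner : FPS
  cubicHorner = FPS-Solver.⟦ cubic z (var (Fin.suc Fin.zero)) ⟧ ρ
  cubic≈0′ : cubicHorner ≈ zeroS
  cubic≈0′ = ≈-trans (≈-sym (+-cong (+-cong (+-cong (poly-horner coeff₀ ρ z ≈-refl)
               (⊛-cong (poly-horner coeff₁ ρ z ≈-refl) (≈-refl {r})))
               (⊛-cong (poly-horner coeff₂ ρ z ≈-refl) (≈-refl {r ^ˢ 2}))) (≈-refl {⊖ (r ^ˢ 3)})))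
             cubic≈0

^ˢ-+ : ∀ f m n → f ^ˢ (m ℕ.+ n) ≈ f ^ˢ m ⊛ f ^ˢ n
^ˢ-+ f zero    n = ≈-sym (*-identityˡ (f ^ˢ n))
^ˢ-+ f (suc m) n = ≈-trans (⊛-cong (≈-refl {f}) (^ˢ-+ f m n)) (≈-sym (*-assoc f (f ^ˢ m) (f ^ˢ n)))

HasOrder : FPS → ℕ → Set
HasOrder f p = ∀ j → j < p → f j ≡ 0ℤ

HasOrder-≤ : ∀ {f p q} → q ≤ p → HasOrder f p → HasOrder f q
HasOrder-≤ q≤p ord j j<q = ord j (ℕ.<-≤-trans j<q q≤p)

HasOrder-cong : ∀ {f g p} → f ≈ g → HasOrder f p → HasOrder g p
HasOrder-cong f≈g ord j j<p = trans (sym (f≈g j)) (ord j j<p)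

HasOrder-⊛ : ∀ {f g} p q → HasOrder f p → HasOrder g q → HasOrder (f ⊛ g) (p ℕ.+ q)
HasOrder-⊛ {f} {g} p q ordf ordg j j<p+q = sumLt-zero (suc j) term
  where
  term : ∀ i → i < suc j → f i * g (j ∸ i) ≡ 0ℤ
  term i i≤j with i ℕ.<? p
  ... | yes i<p = cong (_* g (j ∸ i)) (ordf i i<p)
  ... | no  i≮p = trans (cong (f i *_) (ordg (j ∸ i) j∸i<q)) (ℤ.*-zeroʳ (f i))
    where
    j∸i<q : j ∸ i < q
    j∸i<q = ℕ.+-cancelˡ-< i (j ∸ i) q
      (subst (_< i ℕ.+ q) (sym (ℕ.m+[n∸m]≡n (ℕ.≤-pred i≤j)))
             (ℕ.<-≤-trans j<p+q (ℕ.+-monoˡ-≤ q (ℕ.≮⇒≥ i≮p))))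

HasOrder-^ˢ : ∀ {r} → HasOrder r 1 → ∀ m → HasOrder (r ^ˢ m) m
HasOrder-^ˢ ord zero    j ()
HasOrder-^ˢ ord (suc m) = HasOrder-⊛ 1 m ord (HasOrder-^ˢ ord m)

HasOrder-geometric : ∀ {r W f} t → HasOrder r 1 → f ≈ r ^ˢ t ⊛ W → HasOrder f t
HasOrder-geometric {W = W} t ord f≈ =
  HasOrder-cong (≈-sym f≈) (HasOrder-≤ (ℕ.m≤m+n t 0) (HasOrder-⊛ {g = W} t 0 (HasOrder-^ˢ ord t) λ _ ()))

-- This is Σ_t F t only when F t has order at least t: then no term with t > n reaches z^n.
sumSeries : (ℕ → FPS) → FPS
sumSeries F n = sumLt (suc n) (λ t → F t n)

sumLtS-apply : ∀ L (F : ℕ → FPS) j → sumLtS L F j ≡ sumLt L (λ t → F t j)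
sumLtS-apply zero    F j = refl
sumLtS-apply (suc L) F j = cong (_+ F L j) (sumLtS-apply L F j)

sumSeries-truncate : ∀ {F : ℕ → FPS} → (∀ t → HasOrder (F t) t) →
                     ∀ {j n} → j ≤ n → sumSeries F j ≡ sumLtS (suc n) F j
sumSeries-truncate {F} ord {j} {n} j≤n =
  trans (sym (sumLt-vanishingTail (λ t → F t j) (s≤s j≤n) (λ t j<t → ord t j j<t)))
        (sym (sumLtS-apply (suc n) F j))

telescope-finite : ∀ r W {F : ℕ → FPS} → (∀ t → F t ≈ r ^ˢ t ⊛ W) →
                   ∀ L → (oneS ⊝ r) ⊛ sumLtS L F ≈ W ⊝ r ^ˢ L ⊛ W
telescope-finite r W F≈ zero = begin
  (oneS ⊝ r) ⊛ zeroS ≈⟨ zeroʳ (oneS ⊝ r) ⟩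
  zeroS              ≈⟨ ≈-sym (-‿inverseʳ W) ⟩
  W ⊝ W              ≈⟨ +-cong (≈-refl {W}) (-‿cong (≈-sym (*-identityˡ W))) ⟩
  W ⊝ oneS ⊛ W       ∎
telescope-finite r W {F} F≈ (suc L) = begin
  (oneS ⊝ r) ⊛ (sumLtS L F ⊕ F L)
    ≈⟨ solve 3 (λ x s f → x :* (s :+ f) := x :* s :+ x :* f) ≈-refl (oneS ⊝ r) (sumLtS L F) (F L) ⟩
  (oneS ⊝ r) ⊛ sumLtS L F ⊕ (oneS ⊝ r) ⊛ F L
    ≈⟨ +-cong (telescope-finite r W F≈ L) (⊛-cong (≈-refl {oneS ⊝ r}) (F≈ L)) ⟩
  W ⊝ r ^ˢ L ⊛ W ⊕ (oneS ⊝ r) ⊛ (r ^ˢ L ⊛ W)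
    ≈⟨ solve 3 (λ w R r → w :- R :* w :+ (𝟙 :- r) :* (R :* w) := w :- (r :* R) :* w) ≈-refl W (r ^ˢ L) r ⟩
  W ⊝ r ^ˢ suc L ⊛ W ∎

telescope : ∀ {r} W {F : ℕ → FPS} → HasOrder r 1 → (∀ t → F t ≈ r ^ˢ t ⊛ W) →
            (oneS ⊝ r) ⊛ sumSeries F ≈ W
telescope {r} W {F} ord F≈ n =
  trans (⊛-local (oneS ⊝ r) n (λ j j≤n →
           sumSeries-truncate (λ t → HasOrder-geometric {W = W} t ord (F≈ t)) j≤n))
  (trans (telescope-finite r W F≈ (suc n) n)
  (trans (cong (λ x → W n + - x) (HasOrder-geometric {W = W} (suc n) ord ≈-refl n ℕ.≤-refl))
         (ℤ.+-identityʳ (W n))))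

geometricSum : FPS → FPS
geometricSum r = sumSeries (r ^ˢ_)

geometricSum-inverse : ∀ {r} → HasOrder r 1 → (oneS ⊝ r) ⊛ geometricSum r ≈ oneS
geometricSum-inverse {r} ord = telescope oneS ord (λ t → ≈-sym (*-identityʳ (r ^ˢ t)))

sumSeries-geometric : ∀ {r} W {F : ℕ → FPS} → HasOrder r 1 → (∀ t → F t ≈ r ^ˢ t ⊛ W) →
                      sumSeries F ≈ W ⊛ geometricSum r
sumSeries-geometric {r} W {F} ord F≈ = begin
  s                            ≈⟨ ≈-sym (*-identityʳ s) ⟩
  s ⊛ oneS                     ≈⟨ ⊛-cong (≈-refl {s}) (≈-sym (geometricSum-inverse ord)) ⟩
  s ⊛ ((oneS ⊝ r) ⊛ g)         ≈⟨ solve 3 (λ s x g → s :* (x :* g) := (x :* s) :* g) ≈-refl s (oneS ⊝ r) g ⟩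
  ((oneS ⊝ r) ⊛ s) ⊛ g         ≈⟨ ⊛-cong (telescope W ord F≈) (≈-refl {g}) ⟩
  W ⊛ g                        ∎
  where
  s g : FPS
  s = sumSeries F
  g = geometricSum r

tailSum-sumSeries : ∀ {F : ℕ → FPS} → (∀ t → HasOrder (F t) t) →
                    ∀ i → TailSum F i (sumSeries (λ t → F (suc i ℕ.+ t)))
tailSum-sumSeries {F} ord i n =
  suc n , (λ t n<t → ord (suc i ℕ.+ t) n (ℕ.<-≤-trans n<t (ℕ.m≤n+m t (suc i)))) , refl

module Candidate (r : FPS) (ord : HasOrder r 1)
  (factorised : r ⊛ ((oneS ⊝ r) ⊛ (oneS ⊝ r)) ≈ (Z ⊛ Z) ⊛ (Q r ⊛ Q r)) where

  g Qg : FPS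
  g  = geometricSum r
  Qg = Q r ⊛ g

  Qg-expand : Qg ≈ oneS ⊕ Z ⊛ r ⊛ g
  Qg-expand = begin
    Q r ⊛ g                       ≈⟨ solve 3 (λ r z g → (𝟙 :- r :+ z :* r) :* g := (𝟙 :- r) :* g :+ z :* r :* g)
                                               ≈-refl r Z g ⟩
    (oneS ⊝ r) ⊛ g ⊕ Z ⊛ r ⊛ g     ≈⟨ +-cong (geometricSum-inverse ord) (≈-refl {Z ⊛ r ⊛ g}) ⟩
    oneS ⊕ Z ⊛ r ⊛ g               ∎

  tail-equation : ∀ W {F : ℕ → FPS} → (∀ j → F j ≈ r ^ˢ j ⊛ W) →
              ∀ i → Σ FPS λ s → TailSum F i s × (F i ⊛ Qg ≈ F i ⊕ Z ⊛ s)
  tail-equation W {F} F≈ i =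
    s , tailSum-sumSeries (λ t → HasOrder-geometric {W = W} t ord (F≈ t)) i , (begin
      F i ⊛ Qg                          ≈⟨ ⊛-cong (≈-refl {F i}) Qg-expand ⟩
      F i ⊛ (oneS ⊕ Z ⊛ r ⊛ g)          ≈⟨ solve 4 (λ f z r g → f :* (𝟙 :+ z :* r :* g) := f :+ z :* ((r :* f) :* g))
                                                    ≈-refl (F i) Z r g ⟩
      F i ⊕ Z ⊛ ((r ⊛ F i) ⊛ g)         ≈⟨ +-cong (≈-refl {F i}) (⊛-cong (≈-refl {Z}) (⊛-cong r⊛Fi≈ (≈-refl {g}))) ⟩
      F i ⊕ Z ⊛ ((r ^ˢ suc i ⊛ W) ⊛ g)  ≈⟨ +-cong (≈-refl {F i}) (⊛-cong (≈-refl {Z}) (≈-sym s≈)) ⟩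
      F i ⊕ Z ⊛ s                       ∎)
    where
    s : FPS
    s = sumSeries (λ t → F (suc i ℕ.+ t))
    shifted : ∀ t → F (suc i ℕ.+ t) ≈ r ^ˢ t ⊛ (r ^ˢ suc i ⊛ W)
    shifted t = begin
      F (suc i ℕ.+ t)                ≈⟨ F≈ (suc i ℕ.+ t) ⟩
      r ^ˢ (suc i ℕ.+ t) ⊛ W         ≈⟨ ⊛-cong (^ˢ-+ r (suc i) t) (≈-refl {W}) ⟩
      (r ^ˢ suc i ⊛ r ^ˢ t) ⊛ W      ≈⟨ solve 3 (λ p q w → (p :* q) :* w := q :* (p :* w)) ≈-refl (r ^ˢ suc i) (r ^ˢ t) W ⟩
      r ^ˢ t ⊛ (r ^ˢ suc i ⊛ W)      ∎
    s≈ : s ≈ (r ^ˢ suc i ⊛ W) ⊛ g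
    s≈ = sumSeries-geometric (r ^ˢ suc i ⊛ W) ord shifted
    r⊛Fi≈ : r ⊛ F i ≈ r ^ˢ suc i ⊛ W
    r⊛Fi≈ = ≈-trans (⊛-cong (≈-refl {r}) (F≈ i)) (≈-sym (*-assoc r (r ^ˢ i) W))

  ZQg-square : (Z ⊛ Qg) ⊛ (Z ⊛ Qg) ≈ r
  ZQg-square = begin
    (Z ⊛ Qg) ⊛ (Z ⊛ Qg)
      ≈⟨ solve 3 (λ z q g → (z :* (q :* g)) :* (z :* (q :* g)) := (z :* z) :* (q :* q) :* (g :* g)) ≈-refl Z (Q r) g ⟩
    (Z ⊛ Z) ⊛ (Q r ⊛ Q r) ⊛ (g ⊛ g)
      ≈⟨ ⊛-cong (≈-sym factorised) (≈-refl {g ⊛ g}) ⟩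
    r ⊛ ((oneS ⊝ r) ⊛ (oneS ⊝ r)) ⊛ (g ⊛ g)
      ≈⟨ solve 3 (λ r x g → r :* (x :* x) :* (g :* g) := r :* ((x :* g) :* (x :* g))) ≈-refl r (oneS ⊝ r) g ⟩
    r ⊛ (((oneS ⊝ r) ⊛ g) ⊛ ((oneS ⊝ r) ⊛ g))
      ≈⟨ ⊛-cong (≈-refl {r}) (⊛-cong (geometricSum-inverse ord) (geometricSum-inverse ord)) ⟩
    r ⊛ (oneS ⊛ oneS)
      ≈⟨ ≈-trans (⊛-cong (≈-refl {r}) (*-identityˡ oneS)) (*-identityʳ r) ⟩
    r ∎

  walkA walkB walkC walkD : ℕ → FPS
  walkA k = r ^ˢ k
  walkB k = walkA k ⊛ Qg
  walkC k = Z ⊛ walkB k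
  walkD k = walkC k ⊛ Qg

  walkA-up : ∀ i → walkA (suc i) ≈ Z ⊛ walkD i
  walkA-up i = ≈-sym (begin
    Z ⊛ ((Z ⊛ (R ⊛ Qg)) ⊛ Qg)   ≈⟨ solve 3 (λ z R b → z :* ((z :* (R :* b)) :* b) := (z :* b) :* (z :* b) :* R) ≈-refl Z R Qg ⟩
    (Z ⊛ Qg) ⊛ (Z ⊛ Qg) ⊛ R     ≈⟨ ⊛-cong ZQg-square (≈-refl {R}) ⟩
    r ⊛ R                       ∎)
    where
    R : FPS
    R = r ^ˢ i

  walkC-closed : ∀ k → Z ⊛ (r ⊝ oneS ⊝ Z ⊛ r) ⊛ walkC k ≈ (r ⊝ oneS) ⊛ r ^ˢ suc k
  walkC-closed k = begin
    Z ⊛ (r ⊝ oneS ⊝ Z ⊛ r) ⊛ walkC k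
      ≈⟨ ⊛-cong (solve 2 (λ z r → z :* (r :- 𝟙 :- z :* r) := :- (z :* (𝟙 :- r :+ z :* r))) ≈-refl Z r)
                (≈-sym (*-identityʳ (walkC k))) ⟩
    ⊖ (Z ⊛ Q r) ⊛ (walkC k ⊛ oneS)
      ≈⟨ ⊛-cong (≈-refl {⊖ (Z ⊛ Q r)}) (⊛-cong (≈-refl {walkC k}) (≈-sym (geometricSum-inverse ord))) ⟩
    ⊖ (Z ⊛ Q r) ⊛ (walkC k ⊛ ((oneS ⊝ r) ⊛ g))
      ≈⟨ solve 5 (λ z q R g x → :- (z :* q) :* ((z :* (R :* (q :* g))) :* (x :* g))
                               := (z :* (q :* g)) :* (z :* (q :* g)) :* (:- x :* R))
                 ≈-refl Z (Q r) R g (oneS ⊝ r) ⟩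
    (Z ⊛ Qg) ⊛ (Z ⊛ Qg) ⊛ (⊖ (oneS ⊝ r) ⊛ R)
      ≈⟨ ⊛-cong ZQg-square (≈-refl {⊖ (oneS ⊝ r) ⊛ R}) ⟩
    r ⊛ (⊖ (oneS ⊝ r) ⊛ R)
      ≈⟨ solve 2 (λ r R → r :* (:- (𝟙 :- r) :* R) := (r :- 𝟙) :* (r :* R)) ≈-refl r R ⟩
    (r ⊝ oneS) ⊛ r ^ˢ suc k ∎
    where
    R : FPS
    R = r ^ˢ k

  walk-isWalkSystem : IsWalkSystem walkA walkB walkC walkD
  walk-isWalkSystem =
      ≈-refl
    , walkA-up
    , tail-equation oneS (λ j → ≈-sym (*-identityʳ (walkA j)))
    , (λ i → ≈-refl)
    , tail-equation (Z ⊛ Qg) (λ j → solve 3 (λ z R b → z :* (R :* b) := R :* (z :* b)) ≈-refl Z (r ^ˢ j) Qg)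

TailSum-coefficient : ∀ {f f′ : ℕ → FPS} {i s s′} m → TailSum f i s → TailSum f′ i s′ →
                      (∀ t → f t m ≡ f′ t m) → s m ≡ s′ m
TailSum-coefficient {f} {f′} {i} m tail tail′ f≡f′ with tail m | tail′ m
... | N , vanish , s≡ | N′ , vanish′ , s′≡ =
  trans s≡ (trans (sumLt-cong N (λ t _ → f≡f′ (suc i ℕ.+ t)))
    (trans (sumLt-independent _ (λ t N≤t → trans (sym (f≡f′ (suc i ℕ.+ t))) (vanish t N≤t)) vanish′)
           (sym s′≡)))

module WalkSystemUniqueness (a b c d a′ b′ c′ d′ : ℕ → FPS) where

  record AgreeAt (n : ℕ) : Set where
    field
      a-agree : ∀ i → a i n ≡ a′ i n
      b-agree : ∀ i → b i n ≡ b′ i n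
      c-agree : ∀ i → c i n ≡ c′ i n
      d-agree : ∀ i → d i n ≡ d′ i n
  open AgreeAt

  -- Degree-n coefficients are determined by those of degree n - 1, since each factor z lowers the degree.
  agreeAt-step : IsWalkSystem a b c d → IsWalkSystem a′ b′ c′ d′ →
                 ∀ n → (∀ m → suc m ≡ n → AgreeAt m) → AgreeAt n
  agreeAt-step (a₀ , a-up , b-tail , c-eq , d-tail) (a₀′ , a-up′ , b-tail′ , c-eq′ , d-tail′) n below =
    record { a-agree = aN ; b-agree = bN ; c-agree = cN ; d-agree = dN }
    where
    aN : ∀ i → a i n ≡ a′ i n
    aN zero    = trans (a₀ n) (sym (a₀′ n))
    aN (suc i) = trans (a-up i n)
      (trans (Z-⊛-local (d i) (d′ i) n (λ m m+1≡n → d-agree (below m m+1≡n) i)) (sym (a-up′ i n)))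
    bN : ∀ i → b i n ≡ b′ i n
    bN i with b-tail i | b-tail′ i
    ... | s , tail , b≈ | s′ , tail′ , b≈′ = trans (b≈ n) (trans (cong₂ _+_ (aN i)
          (Z-⊛-local s s′ n (λ m m+1≡n → TailSum-coefficient {a} {a′} m tail tail′ (a-agree (below m m+1≡n)))))
          (sym (b≈′ n)))
    cN : ∀ i → c i n ≡ c′ i n
    cN i = trans (c-eq i n)
      (trans (Z-⊛-local (b i) (b′ i) n (λ m m+1≡n → b-agree (below m m+1≡n) i)) (sym (c-eq′ i n)))
    dN : ∀ i → d i n ≡ d′ i n
    dN i with d-tail i | d-tail′ i
    ... | s , tail , d≈ | s′ , tail′ , d≈′ = trans (d≈ n) (trans (cong₂ _+_ (cN i)
          (Z-⊛-local s s′ n (λ m m+1≡n → TailSum-coefficient {c} {c′} m tail tail′ (c-agree (below m m+1≡n)))))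
          (sym (d≈′ n)))

  agreeAt : IsWalkSystem a b c d → IsWalkSystem a′ b′ c′ d′ → ∀ n → AgreeAt n
  agreeAt S S′ zero    = agreeAt-step S S′ zero (λ _ ())
  agreeAt S S′ (suc n) = agreeAt-step S S′ (suc n) (λ { m refl → agreeAt S S′ n })

walkSystem-unique : (a b c d a′ b′ c′ d′ : ℕ → FPS) → IsWalkSystem a b c d → IsWalkSystem a′ b′ c′ d′ →
                    (∀ i → a i ≈ a′ i) × (∀ i → b i ≈ b′ i) × (∀ i → c i ≈ c′ i) × (∀ i → d i ≈ d′ i)
walkSystem-unique a b c d a′ b′ c′ d′ S S′ =
    (λ i n → a-agree (agreeAt S S′ n) i) , (λ i n → b-agree (agreeAt S S′ n) i)
  , (λ i n → c-agree (agreeAt S S′ n) i) , (λ i n → d-agree (agreeAt S S′ n) i)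
  where
  open WalkSystemUniqueness a b c d a′ b′ c′ d′
  open AgreeAt

record IsLinearInU (L : BPS) (p q : FPS) : Set where
  constructor linearInU
  field
    coeff-0  : L 0 ≈ p
    coeff-1  : L 1 ≈ q
    coeff-2+ : ∀ k → L (suc (suc k)) ≈ zeroS

oneMinusU-isLinearInU : ∀ f → IsLinearInU (oneMinusU f) oneS (⊖ f)
oneMinusU-isLinearInU f = linearInU ≈-refl ≈-refl (λ _ → ≈-refl)

sumLtS-vanishingTail : ∀ {j} n (F : ℕ → FPS) → j ≤ n → (∀ t → j ≤ t → F t ≈ zeroS) →
                       sumLtS n F ≈ sumLtS j F
sumLtS-vanishingTail {j} n F j≤n vanish x =
  trans (sumLtS-apply n F x)
        (trans (sumLt-vanishingTail (λ t → F t x) j≤n (λ t j≤t → vanish t j≤t x))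
               (sym (sumLtS-apply j F x)))

constB-⊛ᵇ : ∀ h F k → (constB h ⊛ᵇ F) k ≈ h ⊛ F k
constB-⊛ᵇ h F k =
  ≈-trans (sumLtS-vanishingTail (suc k) _ (s≤s z≤n) vanish) (λ x → ℤ.+-identityˡ ((h ⊛ F k) x))
  where
  vanish : ∀ t → 1 ≤ t → constB h t ⊛ F (k ∸ t) ≈ zeroS
  vanish (suc t) _ = zeroˡ (F (k ∸ suc t))

constB-isLinearInU : ∀ h {L p q} → IsLinearInU L p q → IsLinearInU (constB h ⊛ᵇ L) (h ⊛ p) (h ⊛ q)
constB-isLinearInU h {L} (linearInU L₀ L₁ L₂₊) = linearInU
  (≈-trans (constB-⊛ᵇ h L 0) (⊛-cong (≈-refl {h}) L₀))
  (≈-trans (constB-⊛ᵇ h L 1) (⊛-cong (≈-refl {h}) L₁))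
  λ k → ≈-trans (constB-⊛ᵇ h L (suc (suc k))) (≈-trans (⊛-cong (≈-refl {h}) (L₂₊ k)) (zeroʳ h))

linearInU-⊛ᵇ-suc : ∀ {L p q} → IsLinearInU L p q → ∀ F k → (L ⊛ᵇ F) (suc k) ≈ p ⊛ F (suc k) ⊕ q ⊛ F k
linearInU-⊛ᵇ-suc {L} {p} {q} (linearInU L₀ L₁ L₂₊) F k = begin
  (L ⊛ᵇ F) (suc k)                         ≈⟨ sumLtS-vanishingTail (suc (suc k)) _ (s≤s (s≤s z≤n)) vanish ⟩
  zeroS ⊕ L 0 ⊛ F (suc k) ⊕ L 1 ⊛ F k      ≈⟨ +-cong (λ x → ℤ.+-identityˡ ((L 0 ⊛ F (suc k)) x)) (≈-refl {L 1 ⊛ F k}) ⟩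
  L 0 ⊛ F (suc k) ⊕ L 1 ⊛ F k              ≈⟨ +-cong (⊛-cong L₀ (≈-refl {F (suc k)})) (⊛-cong L₁ (≈-refl {F k})) ⟩
  p ⊛ F (suc k) ⊕ q ⊛ F k                  ∎
  where
  vanish : ∀ t → 2 ≤ t → L t ⊛ F (suc k ∸ t) ≈ zeroS
  vanish (suc zero)    (s≤s ())
  vanish (suc (suc t)) _ = ≈-trans (⊛-cong (L₂₊ t) (≈-refl {F (k ∸ suc t)})) (zeroˡ (F (k ∸ suc t)))

linearInU-⊛ᵇ-geometric : ∀ {L p q r W} (F : BPS) → IsLinearInU L p q → q ≈ p ⊛ ⊖ r →
                          (∀ k → p ⊛ F k ≈ r ^ˢ k ⊛ W) → L ⊛ᵇ F ≈ᵇ constB W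
linearInU-⊛ᵇ-geometric {L} {p} {q} {r} {W} F (linearInU L₀ _ _) q≈ F≈ zero = begin
  zeroS ⊕ L 0 ⊛ F 0 ≈⟨ (λ x → ℤ.+-identityˡ ((L 0 ⊛ F 0) x)) ⟩
  L 0 ⊛ F 0         ≈⟨ ⊛-cong L₀ (≈-refl {F 0}) ⟩
  p ⊛ F 0           ≈⟨ F≈ 0 ⟩
  oneS ⊛ W          ≈⟨ *-identityˡ W ⟩
  W                 ∎
linearInU-⊛ᵇ-geometric {L} {p} {q} {r} {W} F linear q≈ F≈ (suc k) = begin
  (L ⊛ᵇ F) (suc k)                         ≈⟨ linearInU-⊛ᵇ-suc {L} linear F k ⟩
  p ⊛ F (suc k) ⊕ q ⊛ F k                  ≈⟨ +-cong (F≈ (suc k)) (≈-trans (⊛-cong q≈ (≈-refl {F k}))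
                                                (solve 3 (λ p r f → (p :* :- r) :* f := :- r :* (p :* f)) ≈-refl p r (F k))) ⟩
  r ⊛ R ⊛ W ⊕ ⊖ r ⊛ (p ⊛ F k)             ≈⟨ +-cong (≈-refl {r ⊛ R ⊛ W}) (⊛-cong (≈-refl {⊖ r}) (F≈ k)) ⟩
  r ⊛ R ⊛ W ⊕ ⊖ r ⊛ (R ⊛ W)               ≈⟨ solve 3 (λ r R w → r :* R :* w :+ :- r :* (R :* w) := r :* R :* w :- r :* R :* w)
                                                   ≈-refl r R W ⟩
  r ⊛ R ⊛ W ⊝ r ⊛ R ⊛ W                   ≈⟨ -‿inverseʳ (r ⊛ R ⊛ W) ⟩
  zeroS                                    ∎
  where
  R : FPS
  R = r ^ˢ k

mainTheorem5 : (r : FPS) → IsR r →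
    (a b c d : ℕ → FPS) → IsWalkSystem a b c d →
    (oneMinusU r ⊛ᵇ a ≈ᵇ constB oneS) ×
    (constB (Z ⊛ (r ⊝ oneS ⊝ Z ⊛ r)) ⊛ᵇ oneMinusU r ⊛ᵇ c ≈ᵇ constB ((r ⊝ oneS) ⊛ r)) ×
    (∀ k → a k ≈ r ^ˢ k) ×
    (∀ k → Z ⊛ (r ⊝ oneS ⊝ Z ⊛ r) ⊛ c k ≈ (r ⊝ oneS) ⊛ r ^ˢ suc k) ×
    (∀ k → Z ⊛ b k ≈ c k) ×
    (∀ k → Z ⊛ d k ≈ a (suc k))
mainTheorem5 r isR@(r₀ , _) a b c d walk@(_ , a-up , _ , c-eq , _) =
  a-gf , c-gf , a≈ , c-closed , (λ k → ≈-sym (c-eq k)) , (λ k → ≈-sym (a-up k))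
  where
  order : HasOrder r 1
  order zero    _        = r₀
  order (suc _) (s≤s ())
  open Candidate r order (IsR-factorised isR)
  unique : (∀ i → a i ≈ walkA i) × (∀ i → b i ≈ walkB i) × (∀ i → c i ≈ walkC i) × (∀ i → d i ≈ walkD i)
  unique = walkSystem-unique a b c d walkA walkB walkC walkD walk walk-isWalkSystem
  X : FPS
  X = Z ⊛ (r ⊝ oneS ⊝ Z ⊛ r)
  a≈ : ∀ k → a k ≈ r ^ˢ k
  a≈ = proj₁ unique
  c-closed : ∀ k → X ⊛ c k ≈ (r ⊝ oneS) ⊛ r ^ˢ suc k
  c-closed k = ≈-trans (⊛-cong (≈-refl {X}) (proj₁ (proj₂ (proj₂ unique)) k)) (walkC-closed k)
  a-gf : oneMinusU r ⊛ᵇ a ≈ᵇ constB oneS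
  a-gf = linearInU-⊛ᵇ-geometric a (oneMinusU-isLinearInU r) (≈-sym (*-identityˡ (⊖ r)))
           (λ k → ≈-trans (*-identityˡ (a k)) (≈-trans (a≈ k) (≈-sym (*-identityʳ (r ^ˢ k)))))
  c-gf : constB X ⊛ᵇ oneMinusU r ⊛ᵇ c ≈ᵇ constB ((r ⊝ oneS) ⊛ r)
  c-gf = linearInU-⊛ᵇ-geometric c (constB-isLinearInU X (oneMinusU-isLinearInU r))
           (solve 2 (λ x r → x :* :- r := x :* 𝟙 :* :- r) ≈-refl X r)
           (λ k → ≈-trans (⊛-cong (*-identityʳ X) (≈-refl {c k})) (≈-trans (c-closed k)
              (solve 2 (λ r R → (r :- 𝟙) :* (r :* R) := R :* ((r :- 𝟙) :* r)) ≈-refl r (r ^ˢ k))))
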